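{- Let $r\ge 6$ and let $\mathcal{H}$ be a $K_3^{(2)}$-free multicolored cluster graph with lists in $[r]$. For $j\in[r]$ let $E_j(\mathcal{H})$ be the set of edges whose list has size exactly $j$, and for a $2$-element set $S\subseteq[r]$ and $j\in\{2,\dots,r-4\}$ let $E_j(S,1;\mathcal{H})=\{e\in E_j(\mathcal{H}) : |L_e\cap S|\ge 1\}$. Then: (a) for every $2$-element subset $S\subseteq[r]$, the subgraph of $\mathcal{H}$ with edge set $\bigcup_{j=2}^{r-4}E_j(S,1;\mathcal{H})\cup\bigcup_{\ell=r-3}^{r}E_\ell(\mathcal{H})$ contains no triangle; (b) there exists a $2$-element subset $S\subseteq[r]$ such that $$\left|\bigcup_{j=2}^{r-4}E_j(S,1;\mathcal{H})\right|\ge \sum_{j=2}^{r-4}\frac{\binom r2-\binom{r-j}{2}}{\binom r2}\,|E_j(\mathcal{H})|.$$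
   Context: A multicolored cluster graph is a finite simple graph in which each edge $e$ is assigned a nonempty list $L_e\subseteq[r]$. It is $K_3^{(2)}$-free if there is no triangle together with a choice of one color from each of its three edge lists such that exactly two distinct colors are chosen. -}

module Defs where

open import Data.Nat using (ℕ; zero; suc; _+_; _*_; _∸_; _≤_; _<_; _≤ᵇ_; _<ᵇ_)
open import Data.Nat.Combinatorics using (_C_)
open import Data.Bool using (Bool; true; false; _∧_; _∨_; if_then_else_)
open import Data.Fin using (Fin; toℕ)
open import Data.Fin.Subset using (Subset; _∩_; ∣_∣; Nonempty; _∈_)
open import Data.List using (List; map; upTo; tabulate)
open import Data.Nat.ListAction using (sum)
open import Data.Product using (_×_; Σ-syntax)
open import Data.Sum using (_⊎_)
open import Relation.Binary.PropositionalEquality using (_≡_; _≢_)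
open import Relation.Nullary using (¬_)

-- A multicolored cluster graph on vertex set Fin n with lists in [r] = Fin r.
-- 'edge u v' decides adjacency (finite simple graph: symmetric, loopless);
-- every edge uv carries a nonempty list L u v ⊆ Fin r (same list read from
-- either endpoint).
record MCGraph (r : ℕ) : Set where
  field
    n          : ℕ
    edge       : Fin n → Fin n → Bool
    edge-sym   : ∀ u v → edge u v ≡ edge v u
    edge-irr   : ∀ u → edge u u ≡ false
    L          : Fin n → Fin n → Subset r
    L-sym      : ∀ u v → edge u v ≡ true → L u v ≡ L v u
    L-nonempty : ∀ u v → edge u v ≡ true → Nonempty (L u v)

open MCGraph public

ExactlyTwo : ∀ {r} → Fin r → Fin r → Fin r → Set
ExactlyTwo a b c = (a ≡ b ⊎ b ≡ c ⊎ a ≡ c) × ¬ (a ≡ b × b ≡ c)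

K32-free : ∀ {r} → MCGraph r → Set
K32-free {r} H =
  ∀ (u v w : Fin (n H)) →
  edge H u v ≡ true → edge H v w ≡ true → edge H u w ≡ true →
  ∀ (a b c : Fin r) → a ∈ L H u v → b ∈ L H v w → c ∈ L H u w →
  ¬ ExactlyTwo a b c

countEdges : ∀ {r} (H : MCGraph r) → (Subset r → Bool) → ℕ
countEdges H P =
  sum (tabulate {n = n H} λ u → sum (tabulate {n = n H} λ v →
    if (toℕ u <ᵇ toℕ v) ∧ edge H u v ∧ P (L H u v) then 1 else 0))

sizeIs : ∀ {r} → ℕ → Subset r → Bool
sizeIs j X = (j ≤ᵇ ∣ X ∣) ∧ (∣ X ∣ ≤ᵇ j)

|E| : ∀ {r} → MCGraph r → ℕ → ℕ
|E| H j = countEdges H (sizeIs j)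

inMidS : ∀ {r} → Subset r → Subset r → Bool
inMidS {r} S X = (2 ≤ᵇ ∣ X ∣) ∧ (∣ X ∣ ≤ᵇ (r ∸ 4)) ∧ (1 ≤ᵇ ∣ X ∩ S ∣)

-- membership in ⋃_{ℓ=r-3}^{r} E_ℓ(H):  r-3 ≤ |L|  (|L| ≤ r holds automatically)
inTop : ∀ {r} → Subset r → Bool
inTop {r} X = (r ∸ 3) ≤ᵇ ∣ X ∣

inF : ∀ {r} → Subset r → Subset r → Bool
inF S X = inMidS S X ∨ inTop X

-- Σ_{j=2}^{r-4} f j   (the range 2, 3, ..., r-4 has r-5 elements for r ≥ 6)
sumMid : ℕ → (ℕ → ℕ) → ℕ
sumMid r f = sum (map (λ k → f (2 + k)) (upTo (r ∸ 5)))

-- (a) If the third edge of a triangle has at least two colours, the lists of the other two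
-- edges are disjoint: a common colour x with a colour ≠ x on the third edge would be an
-- exactly-two-colour choice. Every list of the subgraph in (a) has size ≥ 2, so the three
-- lists of a triangle are pairwise disjoint. Their sizes then sum to at most r, which excludes
-- a list of size ≥ r − 3, and their traces on S sum to at most |S| = 2, which excludes three
-- lists meeting S.
-- (b) A list of size j meets exactly C(r,2) − C(r−j,2) of the 2-subsets S of [r]. Summing
-- |⋃ⱼ Eⱼ(S,1)| over all S therefore counts every edge of E_j with that weight, and some S
-- is at least the average.

module Submission where

open import Defs
open import Data.Bool using (Bool; true; false; _∧_; if_then_else_; T)
open import Data.Bool.Properties using (T-≡; T-∧; T-∨)
open import Data.Empty using (⊥; ⊥-elim)
open import Data.Fin using (Fin; zero; suc; toℕ)
import Data.Fin.Properties as Fin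
open import Data.Fin.Subset
  using (Subset; _∩_; _∪_; _∈_; _⊆_; ⁅_⁆; ∣_∣; inside; outside; Nonempty)
open import Data.Fin.Subset.Properties
  using (∣p∣≤n; ∣⊥∣≡0; ∣⁅x⁆∣≡1; ∣⊤∣≡n; ∈⊤; ∩-zeroʳ; x∈p∪q⁻; p⊆q⇒∣p∣≤∣q∣; p∩q⊆p; p∩q⊆q)
open import Data.List
  using (List; []; _∷_; _++_; [_]; map; tabulate; applyUpTo; upTo; allFin; concatMap; length)
open import Data.List.Properties
  using (map-++; map-tabulate; map-applyUpTo; map-∘; map-cong; length-++; length-map; length-tabulate)
open import Data.List.Membership.Propositional using () renaming (_∈_ to _∈ₗ_)
open import Data.List.Relation.Unary.All using (All; []; lookup)
open import Data.List.Relation.Unary.All.Properties using (++⁺; map⁺; tabulate⁺)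
import Data.List.Relation.Unary.Any as Any
open import Data.Nat
  using (ℕ; zero; suc; _+_; _*_; _∸_; _≤_; _<_; _≰_; _≤ᵇ_; _<ᵇ_; z≤n; s≤s; s≤s⁻¹; z<s; s<s)
open import Data.Nat.Combinatorics using (_C_; nC1≡n; nCk+nC[k+1]≡[n+1]C[k+1])
open import Data.Nat.ListAction using (sum)
open import Data.Nat.ListAction.Properties using (sum-++)
open import Data.Nat.Properties
open import Algebra.Properties.CommutativeSemigroup +-commutativeSemigroup using (interchange)
open import Data.Product using (_×_; _,_; proj₁; proj₂; ∃-syntax; Σ-syntax)
open import Data.Sum using (_⊎_; inj₁; inj₂)
open import Data.Vec using ([]; _∷_; here; there)
open import Function using (_∘_; id)
open import Function.Bundles using (Equivalence)
open import Relation.Binary.PropositionalEquality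
  using (_≡_; _≢_; refl; sym; trans; cong; cong₂; subst; module ≡-Reasoning)
open import Relation.Nullary using (¬_; yes; no)

open Equivalence

ind : Bool → ℕ
ind b = if b then 1 else 0

private variable
  I J : Set

sum-map-cong : {f g : I → ℕ} → (∀ x → f x ≡ g x) → ∀ xs → sum (map f xs) ≡ sum (map g xs)
sum-map-cong f≗g xs = cong sum (map-cong f≗g xs)

sum-map-mono : {f g : I → ℕ} → (∀ x → f x ≤ g x) → ∀ xs → sum (map f xs) ≤ sum (map g xs)
sum-map-mono f≤g []       = z≤n
sum-map-mono f≤g (x ∷ xs) = +-mono-≤ (f≤g x) (sum-map-mono f≤g xs)

sum-map-zero : ∀ (xs : List I) → sum (map (λ _ → 0) xs) ≡ 0
sum-map-zero []       = refl
sum-map-zero (x ∷ xs) = sum-map-zero xs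

sum-map-+ : ∀ (f g : I → ℕ) xs →
  sum (map (λ x → f x + g x) xs) ≡ sum (map f xs) + sum (map g xs)
sum-map-+ f g []       = refl
sum-map-+ f g (x ∷ xs) = trans (cong (f x + g x +_) (sum-map-+ f g xs))
                               (interchange (f x) (g x) _ _)

*-distribˡ-sum-map : ∀ c (f : I → ℕ) xs → c * sum (map f xs) ≡ sum (map (λ x → c * f x) xs)
*-distribˡ-sum-map c f []       = *-zeroʳ c
*-distribˡ-sum-map c f (x ∷ xs) = trans (*-distribˡ-+ c (f x) _)
                                        (cong (c * f x +_) (*-distribˡ-sum-map c f xs))

sum-map-comm : ∀ (g : I → J → ℕ) xs ys →
  sum (map (λ x → sum (map (g x) ys)) xs) ≡ sum (map (λ y → sum (map (λ x → g x y) xs)) ys)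
sum-map-comm g []       ys = sym (sum-map-zero ys)
sum-map-comm g (x ∷ xs) ys = trans (cong (sum (map (g x) ys) +_) (sum-map-comm g xs ys))
                                   (sym (sum-map-+ (g x) _ ys))

sum-map-concatMap : ∀ (f : J → ℕ) (g : I → List J) xs →
  sum (map f (concatMap g xs)) ≡ sum (map (λ x → sum (map f (g x))) xs)
sum-map-concatMap f g []       = refl
sum-map-concatMap f g (x ∷ xs) = begin
  sum (map f (g x ++ concatMap g xs))             ≡⟨ cong sum (map-++ f (g x) _) ⟩
  sum (map f (g x) ++ map f (concatMap g xs))     ≡⟨ sum-++ (map f (g x)) _ ⟩
  sum (map f (g x)) + sum (map f (concatMap g xs)) ≡⟨ cong (sum (map f (g x)) +_) (sum-map-concatMap f g xs) ⟩
  sum (map (λ x → sum (map f (g x))) (x ∷ xs))    ∎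
  where open ≡-Reasoning

∃-sum-map≤length* : ∀ (f : I → ℕ) xs → xs ≢ [] →
  ∃[ y ] y ∈ₗ xs × sum (map f xs) ≤ length xs * f y
∃-sum-map≤length* f []            []≢[] = ⊥-elim ([]≢[] refl)
∃-sum-map≤length* f (x ∷ [])      _     = x , Any.here refl , ≤-refl
∃-sum-map≤length* f (x ∷ x′ ∷ xs) _     with ∃-sum-map≤length* f (x′ ∷ xs) (λ ())
... | y , y∈ , avg with f x ≤? f y
...   | yes fx≤fy = y , Any.there y∈ , +-mono-≤ fx≤fy avg
...   | no fx≰fy  = x , Any.here refl ,
                    +-monoʳ-≤ (f x) (≤-trans avg (*-monoʳ-≤ (length (x′ ∷ xs)) (<⇒≤ (≰⇒> fx≰fy))))

sum-tabulate : ∀ {n} (f : Fin n → ℕ) → sum (tabulate f) ≡ sum (map f (allFin n))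
sum-tabulate f = cong sum (sym (map-tabulate id f))

sum-tabulate-1 : ∀ n → sum (tabulate {n = n} (λ _ → 1)) ≡ n
sum-tabulate-1 zero    = refl
sum-tabulate-1 (suc n) = cong suc (sum-tabulate-1 n)

sum-applyUpTo-≡0 : ∀ (f : ℕ → ℕ) m → (∀ k → k < m → f k ≡ 0) → sum (applyUpTo f m) ≡ 0
sum-applyUpTo-≡0 f zero    _   = refl
sum-applyUpTo-≡0 f (suc m) f≡0 =
  cong₂ _+_ (f≡0 0 z<s) (sum-applyUpTo-≡0 (f ∘ suc) m (λ k k<m → f≡0 (suc k) (s<s k<m)))

sum-applyUpTo-≤ : ∀ (f : ℕ → ℕ) m i → (∀ k → k ≢ i → f k ≡ 0) → sum (applyUpTo f m) ≤ f i
sum-applyUpTo-≤ f zero    i       _   = z≤n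
sum-applyUpTo-≤ f (suc m) zero    f≡0 = ≤-reflexive (trans
  (cong (f 0 +_) (sum-applyUpTo-≡0 (f ∘ suc) m (λ k _ → f≡0 (suc k) λ ())))
  (+-identityʳ (f 0)))
sum-applyUpTo-≤ f (suc m) (suc i) f≡0 rewrite f≡0 0 (λ ()) =
  sum-applyUpTo-≤ (f ∘ suc) m i (λ k k≢i → f≡0 (suc k) (k≢i ∘ suc-injective))

Disjoint : ∀ {n} → Subset n → Subset n → Set
Disjoint p q = ∀ {x} → x ∈ p → ¬ x ∈ q

Disjoint-sym : ∀ {n} {p q : Subset n} → Disjoint p q → Disjoint q p
Disjoint-sym p#q x∈q x∈p = p#q x∈p x∈q

Disjoint-∩ : ∀ {n} {p q : Subset n} (s : Subset n) → Disjoint p q → Disjoint (p ∩ s) (q ∩ s)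
Disjoint-∩ {p = p} {q} s p#q x∈p∩s x∈q∩s = p#q (p∩q⊆p p s x∈p∩s) (p∩q⊆p q s x∈q∩s)

∣p∪q∣≡∣p∣+∣q∣ : ∀ {n} {p q : Subset n} → Disjoint p q → ∣ p ∪ q ∣ ≡ ∣ p ∣ + ∣ q ∣
∣p∪q∣≡∣p∣+∣q∣ {p = []}          {[]}          _   = refl
∣p∪q∣≡∣p∣+∣q∣ {p = inside  ∷ p} {inside  ∷ q} p#q = ⊥-elim (p#q here here)
∣p∪q∣≡∣p∣+∣q∣ {p = inside  ∷ p} {outside ∷ q} p#q =
  cong suc (∣p∪q∣≡∣p∣+∣q∣ λ x∈p x∈q → p#q (there x∈p) (there x∈q))
∣p∪q∣≡∣p∣+∣q∣ {p = outside ∷ p} {inside  ∷ q} p#q =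
  trans (cong suc (∣p∪q∣≡∣p∣+∣q∣ λ x∈p x∈q → p#q (there x∈p) (there x∈q))) (sym (+-suc ∣ p ∣ ∣ q ∣))
∣p∪q∣≡∣p∣+∣q∣ {p = outside ∷ p} {outside ∷ q} p#q =
  ∣p∪q∣≡∣p∣+∣q∣ λ x∈p x∈q → p#q (there x∈p) (there x∈q)

Disjoint⇒∣p∣+∣q∣+∣o∣≤∣s∣ : ∀ {n} {p q o s : Subset n} →
  Disjoint p q → Disjoint q o → Disjoint p o → p ⊆ s → q ⊆ s → o ⊆ s →
  ∣ p ∣ + ∣ q ∣ + ∣ o ∣ ≤ ∣ s ∣
Disjoint⇒∣p∣+∣q∣+∣o∣≤∣s∣ {p = p} {q} {o} {s} p#q q#o p#o p⊆s q⊆s o⊆s = begin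
  ∣ p ∣ + ∣ q ∣ + ∣ o ∣ ≡⟨ cong (_+ ∣ o ∣) (∣p∪q∣≡∣p∣+∣q∣ p#q) ⟨
  ∣ p ∪ q ∣ + ∣ o ∣     ≡⟨ ∣p∪q∣≡∣p∣+∣q∣ p∪q#o ⟨
  ∣ (p ∪ q) ∪ o ∣       ≤⟨ p⊆q⇒∣p∣≤∣q∣ p∪q∪o⊆s ⟩
  ∣ s ∣                 ∎
  where
  open ≤-Reasoning
  p∪q#o : Disjoint (p ∪ q) o
  p∪q#o x∈p∪q x∈o with x∈p∪q⁻ p q x∈p∪q
  ... | inj₁ x∈p = p#o x∈p x∈o
  ... | inj₂ x∈q = q#o x∈q x∈o
  p∪q∪o⊆s : (p ∪ q) ∪ o ⊆ s
  p∪q∪o⊆s x∈ with x∈p∪q⁻ (p ∪ q) o x∈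
  ... | inj₂ x∈o = o⊆s x∈o
  ... | inj₁ x∈p∪q with x∈p∪q⁻ p q x∈p∪q
  ...   | inj₁ x∈p = p⊆s x∈p
  ...   | inj₂ x∈q = q⊆s x∈q

1≤∣p∣⇒Nonempty : ∀ {n} {p : Subset n} → 1 ≤ ∣ p ∣ → Nonempty p
1≤∣p∣⇒Nonempty {p = inside  ∷ p} _ = zero , here
1≤∣p∣⇒Nonempty {p = outside ∷ p} 1≤∣p∣ with 1≤∣p∣⇒Nonempty 1≤∣p∣
... | x , x∈p = suc x , there x∈p

∃-∈-≢ : ∀ {n} {p : Subset n} → 2 ≤ ∣ p ∣ → (x : Fin n) → ∃[ y ] y ∈ p × y ≢ x
∃-∈-≢ {p = inside  ∷ p} 2≤∣p∣ zero with 1≤∣p∣⇒Nonempty (s≤s⁻¹ 2≤∣p∣)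
... | y , y∈p = suc y , there y∈p , λ ()
∃-∈-≢ {p = inside  ∷ p} _     (suc x) = zero , here , λ ()
∃-∈-≢ {p = outside ∷ p} 2≤∣p∣ zero with 1≤∣p∣⇒Nonempty (≤-trans (s≤s z≤n) 2≤∣p∣)
... | y , y∈p = suc y , there y∈p , λ ()
∃-∈-≢ {p = outside ∷ p} 2≤∣p∣ (suc x) with ∃-∈-≢ 2≤∣p∣ x
... | y , y∈p , y≢x = suc y , there y∈p , y≢x ∘ Fin.suc-injective

module _ {r} (H : MCGraph r) (free : K32-free H) {u v w : Fin (n H)}
         (uv : edge H u v ≡ true) (vw : edge H v w ≡ true) (uw : edge H u w ≡ true) where

  Disjoint-uv-vw : 2 ≤ ∣ L H u w ∣ → Disjoint (L H u v) (L H v w)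
  Disjoint-uv-vw 2≤∣uw∣ {x} x∈uv x∈vw =
    let c , c∈uw , c≢x = ∃-∈-≢ 2≤∣uw∣ x
    in free u v w uv vw uw x x c x∈uv x∈vw c∈uw (inj₁ refl , λ (_ , x≡c) → c≢x (sym x≡c))

  Disjoint-vw-uw : 2 ≤ ∣ L H u v ∣ → Disjoint (L H v w) (L H u w)
  Disjoint-vw-uw 2≤∣uv∣ {x} x∈vw x∈uw =
    let a , a∈uv , a≢x = ∃-∈-≢ 2≤∣uv∣ x
    in free u v w uv vw uw a x x a∈uv x∈vw x∈uw (inj₂ (inj₁ refl) , λ (a≡x , _) → a≢x a≡x)

  Disjoint-uv-uw : 2 ≤ ∣ L H v w ∣ → Disjoint (L H u v) (L H u w)
  Disjoint-uv-uw 2≤∣vw∣ {x} x∈uv x∈uw =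
    let b , b∈vw , b≢x = ∃-∈-≢ 2≤∣vw∣ x
    in free u v w uv vw uw x b x x∈uv b∈vw x∈uw (inj₂ (inj₂ refl) , λ (x≡b , _) → b≢x (sym x≡b))

module _ {r} (S X : Subset r) where

  inF-cases : inF S X ≡ true → (2 ≤ ∣ X ∣ × 1 ≤ ∣ X ∩ S ∣) ⊎ r ∸ 3 ≤ ∣ X ∣
  inF-cases inF≡true with T-∨ .to (T-≡ .from inF≡true)
  ... | inj₂ top = inj₂ (≤ᵇ⇒≤ (r ∸ 3) _ top)
  ... | inj₁ mid with T-∧ .to mid
  ...   | lo , rest = inj₁ (≤ᵇ⇒≤ 2 _ lo , ≤ᵇ⇒≤ 1 _ (proj₂ (T-∧ .to rest)))

  inF⇒2≤∣X∣ : 5 ≤ r → inF S X ≡ true → 2 ≤ ∣ X ∣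
  inF⇒2≤∣X∣ 5≤r inF≡true with inF-cases inF≡true
  ... | inj₁ (2≤∣X∣ , _) = 2≤∣X∣
  ... | inj₂ top         = ≤-trans (∸-monoˡ-≤ 3 5≤r) top

r∸3+2+2≰r : ∀ {r} → 3 ≤ r → r ∸ 3 + 2 + 2 ≰ r
r∸3+2+2≰r {r} 3≤r = 1+n≰n ∘ subst (_≤ r) r∸3+2+2≡1+r
  where
  r∸3+2+2≡1+r : r ∸ 3 + 2 + 2 ≡ suc r
  r∸3+2+2≡1+r = trans (+-assoc (r ∸ 3) 2 2) (trans (+-comm (r ∸ 3) 4) (cong suc (m+[n∸m]≡n 3≤r)))

noMixedTriangle : ∀ {r} → 5 ≤ r → (H : MCGraph r) → K32-free H → (S : Subset r) → ∣ S ∣ ≡ 2 →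
  ∀ {u v w} → edge H u v ≡ true → edge H v w ≡ true → edge H u w ≡ true →
  inF S (L H u v) ≡ true → inF S (L H v w) ≡ true → inF S (L H u w) ≡ true → ⊥
noMixedTriangle {r} 5≤r H free S ∣S∣≡2 {u} {v} {w} uv vw uw inF₁ inF₂ inF₃ =
  excluded (inF-cases S L₁ inF₁) (inF-cases S L₂ inF₂) (inF-cases S L₃ inF₃)
  where
  L₁ L₂ L₃ : Subset r
  L₁ = L H u v
  L₂ = L H v w
  L₃ = L H u w

  2≤∣L₁∣ : 2 ≤ ∣ L₁ ∣
  2≤∣L₁∣ = inF⇒2≤∣X∣ S L₁ 5≤r inF₁
  2≤∣L₂∣ : 2 ≤ ∣ L₂ ∣
  2≤∣L₂∣ = inF⇒2≤∣X∣ S L₂ 5≤r inF₂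
  2≤∣L₃∣ : 2 ≤ ∣ L₃ ∣
  2≤∣L₃∣ = inF⇒2≤∣X∣ S L₃ 5≤r inF₃

  L₁#L₂ : Disjoint L₁ L₂
  L₁#L₂ = Disjoint-uv-vw H free uv vw uw 2≤∣L₃∣
  L₂#L₃ : Disjoint L₂ L₃
  L₂#L₃ = Disjoint-vw-uw H free uv vw uw 2≤∣L₁∣
  L₁#L₃ : Disjoint L₁ L₃
  L₁#L₃ = Disjoint-uv-uw H free uv vw uw 2≤∣L₂∣

  total : ∀ {p q o} → Disjoint p q → Disjoint q o → Disjoint p o → ∣ p ∣ + ∣ q ∣ + ∣ o ∣ ≤ r
  total p#q q#o p#o = ≤-trans
    (Disjoint⇒∣p∣+∣q∣+∣o∣≤∣s∣ p#q q#o p#o (λ _ → ∈⊤) (λ _ → ∈⊤) (λ _ → ∈⊤)) (≤-reflexive (∣⊤∣≡n r))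

  hits : ∣ L₁ ∩ S ∣ + ∣ L₂ ∩ S ∣ + ∣ L₃ ∩ S ∣ ≤ 2
  hits = ≤-trans (Disjoint⇒∣p∣+∣q∣+∣o∣≤∣s∣
    (Disjoint-∩ S L₁#L₂) (Disjoint-∩ S L₂#L₃) (Disjoint-∩ S L₁#L₃) (p∩q⊆q L₁ S) (p∩q⊆q L₂ S) (p∩q⊆q L₃ S))
    (≤-reflexive ∣S∣≡2)

  oversized : ∀ {x y z} → r ∸ 3 ≤ x → 2 ≤ y → 2 ≤ z → x + y + z ≤ r → ⊥
  oversized top 2≤y 2≤z x+y+z≤r =
    r∸3+2+2≰r (≤-trans (m≤m+n 3 2) 5≤r) (≤-trans (+-mono-≤ (+-mono-≤ top 2≤y) 2≤z) x+y+z≤r)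

  excluded : (2 ≤ ∣ L₁ ∣ × 1 ≤ ∣ L₁ ∩ S ∣) ⊎ r ∸ 3 ≤ ∣ L₁ ∣ →
             (2 ≤ ∣ L₂ ∣ × 1 ≤ ∣ L₂ ∩ S ∣) ⊎ r ∸ 3 ≤ ∣ L₂ ∣ →
             (2 ≤ ∣ L₃ ∣ × 1 ≤ ∣ L₃ ∩ S ∣) ⊎ r ∸ 3 ≤ ∣ L₃ ∣ → ⊥
  excluded (inj₁ (_ , a)) (inj₁ (_ , b)) (inj₁ (_ , c)) = 1+n≰n (≤-trans (+-mono-≤ (+-mono-≤ a b) c) hits)
  excluded (inj₂ top) _ _ = oversized top 2≤∣L₂∣ 2≤∣L₃∣ (total L₁#L₂ L₂#L₃ L₁#L₃)
  excluded _ (inj₂ top) _ = oversized top 2≤∣L₁∣ 2≤∣L₃∣ (total (Disjoint-sym L₁#L₂) L₁#L₃ L₂#L₃)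
  excluded _ _ (inj₂ top) = oversized top 2≤∣L₁∣ 2≤∣L₂∣ (total (Disjoint-sym L₁#L₃) L₁#L₂ (Disjoint-sym L₂#L₃))

pairWith₀ : ∀ {r} → Fin r → Subset (suc r)
pairWith₀ k = inside ∷ ⁅ k ⁆

shift : ∀ {r} → Subset r → Subset (suc r)
shift S = outside ∷ S

twoSets : (r : ℕ) → List (Subset r)
twoSets zero    = []
twoSets (suc r) = tabulate {n = r} pairWith₀ ++ map shift (twoSets r)

twoSets-size : ∀ r → All (λ S → ∣ S ∣ ≡ 2) (twoSets r)
twoSets-size zero    = []
twoSets-size (suc r) = ++⁺ (tabulate⁺ (cong suc ∘ ∣⁅x⁆∣≡1)) (map⁺ (twoSets-size r))

twoSets≢[] : ∀ {r} → 2 ≤ r → twoSets r ≢ []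
twoSets≢[] (s≤s (s≤s z≤n)) ()

[1+m]C2≡m+mC2 : ∀ m → suc m C 2 ≡ m + m C 2
[1+m]C2≡m+mC2 m = trans (sym (nCk+nC[k+1]≡[n+1]C[k+1] m 1)) (cong (_+ m C 2) (nC1≡n m))

length-twoSets : ∀ r → length (twoSets r) ≡ r C 2
length-twoSets zero    = refl
length-twoSets (suc r) = begin
  length (tabulate {n = r} pairWith₀ ++ map shift (twoSets r))
    ≡⟨ length-++ (tabulate {n = r} pairWith₀) {map shift (twoSets r)} ⟩
  length (tabulate {n = r} pairWith₀) + length (map shift (twoSets r))
    ≡⟨ cong₂ _+_ (length-tabulate _) (trans (length-map _ (twoSets r)) (length-twoSets r)) ⟩
  r + r C 2
    ≡⟨ [1+m]C2≡m+mC2 r ⟨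
  suc r C 2 ∎
  where open ≡-Reasoning

sum-map-twoSets : ∀ {r} (f : Subset (suc r) → ℕ) →
  sum (map f (twoSets (suc r))) ≡
  sum (tabulate (f ∘ pairWith₀)) + sum (map (f ∘ shift) (twoSets r))
sum-map-twoSets {r} f = begin
  sum (map f (tabulate {n = r} pairWith₀ ++ map shift (twoSets r)))
    ≡⟨ cong sum (map-++ f (tabulate {n = r} pairWith₀) _) ⟩
  sum (map f (tabulate {n = r} pairWith₀) ++ map f (map shift (twoSets r)))
    ≡⟨ sum-++ (map f (tabulate {n = r} pairWith₀)) _ ⟩
  sum (map f (tabulate {n = r} pairWith₀)) + sum (map f (map shift (twoSets r)))
    ≡⟨ cong₂ _+_ (cong sum (map-tabulate pairWith₀ f)) (cong sum (sym (map-∘ (twoSets r)))) ⟩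
  sum (tabulate (f ∘ pairWith₀)) + sum (map (f ∘ shift) (twoSets r)) ∎
  where open ≡-Reasoning

meets : ∀ {r} → Subset r → Subset r → Bool
meets X S = 1 ≤ᵇ ∣ X ∩ S ∣

meetingCount : ∀ {r} → Subset r → ℕ
meetingCount {r} X = sum (map (λ S → ind (meets X S)) (twoSets r))

meetingNumber : ℕ → ℕ → ℕ
meetingNumber r j = r C 2 ∸ (r ∸ j) C 2

sum-meets-singletons : ∀ {r} (X : Subset r) → sum (tabulate (λ k → ind (meets X ⁅ k ⁆))) ≡ ∣ X ∣
sum-meets-singletons []            = refl
sum-meets-singletons (inside  ∷ X) = cong suc (sum-meets-singletons X)
sum-meets-singletons {suc r} (outside ∷ X) rewrite ∩-zeroʳ X | ∣⊥∣≡0 r = sum-meets-singletons X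

meetingCount-inside : ∀ {r} (X : Subset r) → meetingCount (inside ∷ X) ≡ r + meetingCount X
meetingCount-inside {r} X =
  trans (sum-map-twoSets (λ S → ind (meets (inside ∷ X) S))) (cong (_+ meetingCount X) (sum-tabulate-1 r))

meetingCount-outside : ∀ {r} (X : Subset r) → meetingCount (outside ∷ X) ≡ ∣ X ∣ + meetingCount X
meetingCount-outside X =
  trans (sum-map-twoSets (λ S → ind (meets (outside ∷ X) S))) (cong (_+ meetingCount X) (sum-meets-singletons X))

meetingCount+avoiding≡total : ∀ {r} (X : Subset r) → meetingCount X + (r ∸ ∣ X ∣) C 2 ≡ r C 2
meetingCount+avoiding≡total [] = refl
meetingCount+avoiding≡total {suc r} (inside ∷ X) = begin
  meetingCount (inside ∷ X) + (r ∸ ∣ X ∣) C 2 ≡⟨ cong (_+ (r ∸ ∣ X ∣) C 2) (meetingCount-inside X) ⟩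
  r + meetingCount X + (r ∸ ∣ X ∣) C 2         ≡⟨ +-assoc r _ _ ⟩
  r + (meetingCount X + (r ∸ ∣ X ∣) C 2)       ≡⟨ cong (r +_) (meetingCount+avoiding≡total X) ⟩
  r + r C 2                                    ≡⟨ [1+m]C2≡m+mC2 r ⟨
  suc r C 2                                    ∎
  where open ≡-Reasoning
meetingCount+avoiding≡total {suc r} (outside ∷ X) = begin
  meetingCount (outside ∷ X) + (suc r ∸ ∣ X ∣) C 2
    ≡⟨ cong₂ _+_ (meetingCount-outside X) (cong (_C 2) (+-∸-assoc 1 (∣p∣≤n X))) ⟩
  ∣ X ∣ + meetingCount X + suc (r ∸ ∣ X ∣) C 2
    ≡⟨ cong (∣ X ∣ + meetingCount X +_) ([1+m]C2≡m+mC2 (r ∸ ∣ X ∣)) ⟩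
  ∣ X ∣ + meetingCount X + ((r ∸ ∣ X ∣) + (r ∸ ∣ X ∣) C 2)
    ≡⟨ interchange ∣ X ∣ (meetingCount X) _ _ ⟩
  ∣ X ∣ + (r ∸ ∣ X ∣) + (meetingCount X + (r ∸ ∣ X ∣) C 2)
    ≡⟨ cong₂ _+_ (m+[n∸m]≡n (∣p∣≤n X)) (meetingCount+avoiding≡total X) ⟩
  r + r C 2
    ≡⟨ [1+m]C2≡m+mC2 r ⟨
  suc r C 2 ∎
  where open ≡-Reasoning

meetingCount≡meetingNumber : ∀ {r} (X : Subset r) → meetingCount X ≡ meetingNumber r ∣ X ∣
meetingCount≡meetingNumber {r} X =
  trans (sym (m+n∸n≡m (meetingCount X) ((r ∸ ∣ X ∣) C 2)))
        (cong (_∸ (r ∸ ∣ X ∣) C 2) (meetingCount+avoiding≡total X))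

sizeIs-∣X∣ : ∀ {r} (X : Subset r) → sizeIs ∣ X ∣ X ≡ true
sizeIs-∣X∣ X = T-≡ .to (T-∧ .from (≤⇒≤ᵇ (≤-refl {∣ X ∣}) , ≤⇒≤ᵇ (≤-refl {∣ X ∣})))

sizeIs-≢ : ∀ {r j} (X : Subset r) → j ≢ ∣ X ∣ → sizeIs j X ≡ false
sizeIs-≢ {j = j} X j≢∣X∣ with sizeIs j X in eq
... | false = refl
... | true  = ⊥-elim (j≢∣X∣ (≤-antisym (≤ᵇ⇒≤ j _ j≤) (≤ᵇ⇒≤ _ j ≤j)))
  where
  j≤ : T (j ≤ᵇ ∣ X ∣)
  j≤ = proj₁ (T-∧ .to (T-≡ .from eq))
  ≤j : T (∣ X ∣ ≤ᵇ j)
  ≤j = proj₂ (T-∧ .to (T-≡ .from eq))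

≤ᵇ≡false⇒≰ : ∀ {m n} → (m ≤ᵇ n) ≡ false → m ≰ n
≤ᵇ≡false⇒≰ m≤ᵇn≡false m≤n = subst T m≤ᵇn≡false (≤⇒≤ᵇ m≤n)

≤ᵇ≡true⇒≤ : ∀ {m n} → (m ≤ᵇ n) ≡ true → m ≤ n
≤ᵇ≡true⇒≤ {m} {n} m≤ᵇn≡true = ≤ᵇ⇒≤ m n (T-≡ .from m≤ᵇn≡true)

sumMid-applyUpTo : ∀ r (g : ℕ → ℕ) → sumMid r g ≡ sum (applyUpTo (g ∘ (2 +_)) (r ∸ 5))
sumMid-applyUpTo r g = cong sum (map-applyUpTo id (g ∘ (2 +_)) (r ∸ 5))

k<r∸5⇒2+k≤r∸4 : ∀ {k} r → k < r ∸ 5 → 2 + k ≤ r ∸ 4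
k<r∸5⇒2+k≤r∸4 {k} r k<r∸5 = 2+k≤m (subst (k <_) (sym (∸-+-assoc r 4 1)) k<r∸5)
  where
  2+k≤m : ∀ {k m} → k < m ∸ 1 → 2 + k ≤ m
  2+k≤m {m = suc m} k<m = s≤s k<m

module _ {r} (X : Subset r) where

  sizeTerm : ℕ → ℕ
  sizeTerm j = meetingNumber r j * ind (sizeIs j X)

  sizeTerm-≢ : ∀ {j} → j ≢ ∣ X ∣ → sizeTerm j ≡ 0
  sizeTerm-≢ {j} j≢∣X∣ rewrite sizeIs-≢ X j≢∣X∣ = *-zeroʳ (meetingNumber r j)

  sizeTerm-∣X∣ : sizeTerm ∣ X ∣ ≡ meetingNumber r ∣ X ∣
  sizeTerm-∣X∣ rewrite sizeIs-∣X∣ X = *-identityʳ (meetingNumber r ∣ X ∣)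

  sumMid-sizeTerm≡0 : (∀ k → k < r ∸ 5 → 2 + k ≢ ∣ X ∣) → sumMid r sizeTerm ≡ 0
  sumMid-sizeTerm≡0 off = trans (sumMid-applyUpTo r sizeTerm)
    (sum-applyUpTo-≡0 _ (r ∸ 5) λ k k<r∸5 → sizeTerm-≢ {2 + k} (off k k<r∸5))

  sumMid-sizeTerm≤meetingCount : 2 ≤ ∣ X ∣ → sumMid r sizeTerm ≤ meetingCount X
  sumMid-sizeTerm≤meetingCount 2≤∣X∣ = begin
    sumMid r sizeTerm                               ≡⟨ sumMid-applyUpTo r sizeTerm ⟩
    sum (applyUpTo (sizeTerm ∘ (2 +_)) (r ∸ 5))     ≤⟨ sum-applyUpTo-≤ _ (r ∸ 5) (∣ X ∣ ∸ 2) off ⟩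
    sizeTerm (2 + (∣ X ∣ ∸ 2))                      ≡⟨ cong sizeTerm (m+[n∸m]≡n 2≤∣X∣) ⟩
    sizeTerm ∣ X ∣                                  ≡⟨ sizeTerm-∣X∣ ⟩
    meetingNumber r ∣ X ∣                           ≡⟨ meetingCount≡meetingNumber X ⟨
    meetingCount X                                  ∎
    where
    open ≤-Reasoning
    off : ∀ k → k ≢ ∣ X ∣ ∸ 2 → sizeTerm (2 + k) ≡ 0
    off k k≢ = sizeTerm-≢ {2 + k} λ 2+k≡∣X∣ → k≢ (cong (_∸ 2) 2+k≡∣X∣)

  -- The right-hand side is inMidS S X unfolded, so that with can abstract its size tests.
  sumMid-sizeTerm≤ : sumMid r sizeTerm ≤
    sum (map (λ S → ind ((2 ≤ᵇ ∣ X ∣) ∧ (∣ X ∣ ≤ᵇ r ∸ 4) ∧ meets X S)) (twoSets r))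
  sumMid-sizeTerm≤ with 2 ≤ᵇ ∣ X ∣ in lo | ∣ X ∣ ≤ᵇ r ∸ 4 in hi
  ... | false | _     = ≤-trans (≤-reflexive (sumMid-sizeTerm≡0 λ k _ 2+k≡∣X∣ →
                          ≤ᵇ≡false⇒≰ lo (≤-trans (m≤m+n 2 k) (≤-reflexive 2+k≡∣X∣)))) z≤n
  ... | true  | false = ≤-trans (≤-reflexive (sumMid-sizeTerm≡0 λ k k<r∸5 2+k≡∣X∣ →
                          ≤ᵇ≡false⇒≰ hi (subst (_≤ r ∸ 4) 2+k≡∣X∣ (k<r∸5⇒2+k≤r∸4 r k<r∸5)))) z≤n
  ... | true  | true  = sumMid-sizeTerm≤meetingCount (≤ᵇ≡true⇒≤ lo)

edgeSlot : ∀ {r} (H : MCGraph r) → Fin (n H) → Fin (n H) → List (Subset r)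
edgeSlot H u v = if (toℕ u <ᵇ toℕ v) ∧ edge H u v then [ L H u v ] else []

labels : ∀ {r} → MCGraph r → List (Subset r)
labels H = concatMap (λ u → concatMap (edgeSlot H u) (allFin (n H))) (allFin (n H))

ind-∧-∧ : ∀ a b (P : I → Bool) x →
  ind (a ∧ b ∧ P x) ≡ sum (map (ind ∘ P) (if a ∧ b then [ x ] else []))
ind-∧-∧ true  true  P x = sym (+-identityʳ (ind (P x)))
ind-∧-∧ true  false P x = refl
ind-∧-∧ false b     P x = refl

countEdges≡sum-labels : ∀ {r} (H : MCGraph r) (P : Subset r → Bool) →
  countEdges H P ≡ sum (map (ind ∘ P) (labels H))
countEdges≡sum-labels H P = begin
  countEdges H P
    ≡⟨ sum-tabulate {n H} _ ⟩
  sum (map (λ u → sum (tabulate λ v → ind ((toℕ u <ᵇ toℕ v) ∧ edge H u v ∧ P (L H u v)))) vs)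
    ≡⟨ sum-map-cong (λ u → sum-tabulate {n H} _) vs ⟩
  sum (map (λ u → sum (map (λ v → ind ((toℕ u <ᵇ toℕ v) ∧ edge H u v ∧ P (L H u v))) vs)) vs)
    ≡⟨ sum-map-cong (λ u → sum-map-cong (λ v → ind-∧-∧ (toℕ u <ᵇ toℕ v) (edge H u v) P (L H u v)) vs) vs ⟩
  sum (map (λ u → sum (map (λ v → sum (map (ind ∘ P) (edgeSlot H u v))) vs)) vs)
    ≡⟨ sum-map-cong (λ u → sum-map-concatMap (ind ∘ P) (edgeSlot H u) vs) vs ⟨
  sum (map (λ u → sum (map (ind ∘ P) (concatMap (edgeSlot H u) vs))) vs)
    ≡⟨ sum-map-concatMap (ind ∘ P) (λ u → concatMap (edgeSlot H u) vs) vs ⟨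
  sum (map (ind ∘ P) (labels H)) ∎
  where
  open ≡-Reasoning
  vs : List (Fin (n H))
  vs = allFin (n H)

weighted-|E|≤sum-countEdges : ∀ {r} (H : MCGraph r) →
  sumMid r (λ j → meetingNumber r j * |E| H j) ≤ sum (map (λ S → countEdges H (inMidS S)) (twoSets r))
weighted-|E|≤sum-countEdges {r} H = begin
  sum (map (λ k → meetingNumber r (2 + k) * |E| H (2 + k)) ks)
    ≡⟨ sum-map-cong (λ k → cong (meetingNumber r (2 + k) *_) (countEdges≡sum-labels H (sizeIs (2 + k)))) ks ⟩
  sum (map (λ k → meetingNumber r (2 + k) * sum (map (ind ∘ sizeIs (2 + k)) E)) ks)
    ≡⟨ sum-map-cong (λ k → *-distribˡ-sum-map (meetingNumber r (2 + k)) _ E) ks ⟩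
  sum (map (λ k → sum (map (λ X → sizeTerm X (2 + k)) E)) ks)
    ≡⟨ sum-map-comm (λ k X → sizeTerm X (2 + k)) ks E ⟩
  sum (map (λ X → sumMid r (sizeTerm X)) E)
    ≤⟨ sum-map-mono sumMid-sizeTerm≤ E ⟩
  sum (map (λ X → sum (map (λ S → ind (inMidS S X)) pairs)) E)
    ≡⟨ sum-map-comm (λ X S → ind (inMidS S X)) E pairs ⟩
  sum (map (λ S → sum (map (ind ∘ inMidS S) E)) pairs)
    ≡⟨ sum-map-cong (λ S → countEdges≡sum-labels H (inMidS S)) pairs ⟨
  sum (map (λ S → countEdges H (inMidS S)) pairs) ∎
  where
  open ≤-Reasoning
  ks : List ℕ
  ks = upTo (r ∸ 5)
  E : List (Subset r)
  E = labels H
  pairs : List (Subset r)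
  pairs = twoSets r

∃-pair-meeting-many : ∀ {r} → 2 ≤ r → (H : MCGraph r) →
  Σ[ S ∈ Subset r ] (∣ S ∣ ≡ 2 ×
    sumMid r (λ j → meetingNumber r j * |E| H j) ≤ (r C 2) * countEdges H (inMidS S))
∃-pair-meeting-many {r} 2≤r H
  with ∃-sum-map≤length* (λ S → countEdges H (inMidS S)) (twoSets r) (twoSets≢[] 2≤r)
... | S , S∈twoSets , average = S , lookup (twoSets-size r) S∈twoSets , (begin
  sumMid r (λ j → meetingNumber r j * |E| H j)          ≤⟨ weighted-|E|≤sum-countEdges H ⟩
  sum (map (λ S′ → countEdges H (inMidS S′)) (twoSets r)) ≤⟨ average ⟩
  length (twoSets r) * countEdges H (inMidS S)           ≡⟨ cong (_* countEdges H (inMidS S)) (length-twoSets r) ⟩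
  (r C 2) * countEdges H (inMidS S)                      ∎)
  where open ≤-Reasoning

propositionA1 : (r : ℕ) → 6 ≤ r → (H : MCGraph r) → K32-free H →
    ((S : Subset r) → ∣ S ∣ ≡ 2 →
      ¬ (Σ[ u ∈ Fin (n H) ] Σ[ v ∈ Fin (n H) ] Σ[ w ∈ Fin (n H) ]
          (u ≢ v × v ≢ w × u ≢ w ×
           edge H u v ≡ true × edge H v w ≡ true × edge H u w ≡ true ×
           inF S (L H u v) ≡ true × inF S (L H v w) ≡ true × inF S (L H u w) ≡ true)))
    ×
    (Σ[ S ∈ Subset r ] (∣ S ∣ ≡ 2 ×
      sumMid r (λ j → ((r C 2) ∸ ((r ∸ j) C 2)) * |E| H j)
        ≤ (r C 2) * countEdges H (inMidS S)))
propositionA1 r 6≤r H free =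
  (λ S ∣S∣≡2 (_ , _ , _ , _ , _ , _ , uv , vw , uw , inF-uv , inF-vw , inF-uw) →
     noMixedTriangle (<⇒≤ 6≤r) H free S ∣S∣≡2 uv vw uw inF-uv inF-vw inF-uw) ,
  ∃-pair-meeting-many (≤-trans (m≤m+n 2 4) 6≤r) H
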